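{- Let $n,k$ be positive integers with $k\ge 3$, and let $W := Y(1,1) \cup \bigcup_{i=2}^{k-1} Y(2,i)$. The subgraph of $H(n,k)$ induced by $W$ has maximum degree $1$.
   Context: The Hamming graph $H(n,k)$ has vertex set $\mathbb{Z}_k^n$ with $\mathbb{Z}_k=\{0,1,\dots,k-1\}$, two vertices being adjacent iff they differ in exactly one coordinate; $v(i)$ is the $i$-th coordinate of $v$ and arithmetic is modulo $k$. For $v \neq (0,\dots,0)$, $\ell(v)$ is the largest index $i$ with $v(i)\neq 0$. For $s,t\in\mathbb{Z}_k$ with $t\neq 0$, $Y(s,t)$ is the set of nonzero vertices $v$ with $\sum_{i=1}^n v(i)\equiv s \pmod k$ and $v(\ell(v)) = t$. -}

module Defs where

open import Data.Nat using (ℕ; zero; suc; _+_; _≤_)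
open import Data.Integer using (ℤ; +_; _-_)
open import Data.Integer.Divisibility using (_∣_)
open import Data.Fin using (Fin; toℕ)
open import Data.Vec using (Vec; []; _∷_; lookup)
open import Data.Maybe using (Maybe; just; nothing)
open import Data.Product using (Σ; _×_; ∃; ∃-syntax; _,_)
open import Data.Sum using (_⊎_)
open import Relation.Binary.PropositionalEquality using (_≡_; _≢_)

-- Vertices of H(n,k): vectors in Z_k^n, coordinate i (1-based in the paper)
-- is position i-1 of the vector; Z_k is Fin k.
Vertex : ℕ → ℕ → Set
Vertex n k = Vec (Fin k) n

Adj : ∀ {n k} → Vertex n k → Vertex n k → Set
Adj {n} v w = Σ (Fin n) λ i → (lookup v i ≢ lookup w i) ×
                 (∀ j → j ≢ i → lookup v j ≡ lookup w j)

-- Sum of coordinates as a natural number (reduce mod k afterwards).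
coordSum : ∀ {n k} → Vertex n k → ℕ
coordSum [] = 0
coordSum (x ∷ v) = toℕ x + coordSum v

-- v(ℓ(v)): the value at the largest index with nonzero entry;
-- nothing iff v is the zero vector.
leadVal : ∀ {n k} → Vertex n k → Maybe (Fin k)
leadVal [] = nothing
leadVal (x ∷ v) with leadVal v
... | just t = just t
... | nothing with toℕ x
...   | zero = nothing
...   | suc _ = just x

-- Y(s,t) for t ≠ 0: nonzero v with sum ≡ s (mod k) and v(ℓ(v)) = t.
-- (leadVal v ≡ just t already forces v ≠ 0.)
InY : ∀ {n k} → ℕ → Fin k → Vertex n k → Set
InY {k = k} s t v = ((+ k) ∣ (+ coordSum v - + s)) × (leadVal v ≡ just t)

InW : ∀ {n k} → Vertex n k → Set
InW {k = k} v =
  (Σ (Fin k) λ t → toℕ t ≡ 1 × InY 1 t v) ⊎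
  (Σ (Fin k) λ i → 2 ≤ toℕ i × InY 2 i v)

{-# OPTIONS --safe #-}
-- Changing one coordinate changes the coordinate sum, so an edge inside W joins
-- Y(1,1) to some Y(2,t), and the two sums force w(i) ≡ v(i) ± 1: the new value
-- is determined by the old one. The changed coordinate i must moreover be ℓ(v).
-- Otherwise either the leading value is unchanged, which is impossible as it is
-- 1 on one side and at least 2 on the other; or v(i) = 0 and w(i) becomes the
-- leading value of w; the congruence then forces w(i) = 1, absurd for
-- w ∈ Y(2,t), or makes k divide 2 when w ∈ Y(1,1). So a vertex of W has at most one
-- neighbour in W, and (1,0,…,0) ~ (2,0,…,0) is an edge.
module Submission where

open import Defs
open import Data.Nat using (ℕ; zero; suc; _+_; _∸_; _≤_; _<_; _≥_; s≤s; z≤n)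
open import Data.Nat.Properties
  using (+-assoc; +-comm; +-identityʳ; ≤-trans; ≤-total; ≤-antisym; ≤-<-trans;
         m∸n≤m; m∸n≡0⇒m≤n; <⇒≢)
open import Data.Nat.Divisibility using (>⇒∤; _∣0) renaming (_∣_ to _ℕ∣_)
open import Data.Nat.Solver using () renaming (module +-*-Solver to ℕ-Solver)
open import Data.Integer as ℤ using (+_; _-_)
open import Data.Integer.Properties
  using (∣i-j∣≡∣j-i∣; [+m]-[+n]≡m⊖n; ∣⊖∣-≤; n⊖n≡0; pos-+)
open import Data.Integer.Divisibility using (_∣_)
open import Data.Integer.Divisibility.Signed as Signed using (∣ᵤ⇒∣; ∣⇒∣ᵤ; ∣m∣n⇒∣m+n)
open import Data.Integer.Solver using (module +-*-Solver)
open import Data.Fin using (Fin; toℕ; _≟_) renaming (zero to fzero; suc to fsuc)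
open import Data.Fin.Properties using (toℕ-injective; toℕ<n)
open import Data.Vec using ([]; _∷_; lookup; replicate; _[_]≔_)
open import Data.Vec.Properties using (lookup∘update; lookup∘update′)
open import Data.Vec.Relation.Binary.Pointwise.Extensional using (ext; Pointwise-≡⇒≡)
open import Data.Maybe using (Maybe; just; nothing)
open import Data.Maybe.Properties using (just-injective)
open import Data.Product using (Σ; _×_; _,_; ∃₂)
open import Data.Sum using (_⊎_; inj₁; inj₂)
open import Data.Empty using (⊥; ⊥-elim)
open import Relation.Nullary using (yes; no)
open import Relation.Binary.PropositionalEquality
  using (_≡_; _≢_; refl; sym; trans; cong; cong₂; subst; subst₂; module ≡-Reasoning)

private
  variable
    n k a b c s s′ : ℕ

infix 4 _≡_mod_

record _≡_mod_ (a b k : ℕ) : Set where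
  constructor mk≡mod
  field divides : + k ∣ + a - + b

mod-reflexive : a ≡ b → a ≡ b mod k
mod-reflexive {a} {k = k} refl =
  mk≡mod (subst (+ k ∣_) (sym (trans ([+m]-[+n]≡m⊖n a a) (n⊖n≡0 a))) (k ∣0))

mod-sym : a ≡ b mod k → b ≡ a mod k
mod-sym {a} {b} {k} (mk≡mod k∣a-b) =
  mk≡mod (subst (λ m → + k ∣ + m) (∣i-j∣≡∣j-i∣ (+ a) (+ b)) k∣a-b)

mod-trans : a ≡ b mod k → b ≡ c mod k → a ≡ c mod k
mod-trans {a} {b} {k} {c} (mk≡mod k∣a-b) (mk≡mod k∣b-c) =
  mk≡mod (∣⇒∣ᵤ (subst (+ k Signed.∣_) (telescope (+ a) (+ b) (+ c))
    (∣m∣n⇒∣m+n (∣ᵤ⇒∣ {+ k} {+ a - + b} k∣a-b) (∣ᵤ⇒∣ {+ k} {+ b - + c} k∣b-c))))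
  where
  open +-*-Solver
  telescope : ∀ x y z → (x - y) ℤ.+ (y - z) ≡ x - z
  telescope = solve 3 (λ x y z → (x :- y) :+ (y :- z) := x :- z) refl

[c+a]-[c+b]≡a-b : ∀ c a b → + (c + a) - + (c + b) ≡ + a - + b
[c+a]-[c+b]≡a-b c a b = begin
  + (c + a) - + (c + b)          ≡⟨ cong₂ _-_ (pos-+ c a) (pos-+ c b) ⟩
  (+ c ℤ.+ + a) - (+ c ℤ.+ + b)  ≡⟨ solve 3 (λ x y z → (z :+ x) :- (z :+ y) := x :- y) refl (+ a) (+ b) (+ c) ⟩
  + a - + b                      ∎
  where open ≡-Reasoning; open +-*-Solver

mod-+ˡ : a ≡ b mod k → c + a ≡ c + b mod k
mod-+ˡ {a} {b} {k} {c} (mk≡mod k∣a-b) = mk≡mod (subst (+ k ∣_) (sym ([c+a]-[c+b]≡a-b c a b)) k∣a-b)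

mod-+ʳ : a ≡ b mod k → a + c ≡ b + c mod k
mod-+ʳ {a} {b} {k} {c} a≡b = subst₂ (λ x y → x ≡ y mod k) (+-comm c a) (+-comm c b) (mod-+ˡ a≡b)

mod-cancelˡ : c + a ≡ c + b mod k → a ≡ b mod k
mod-cancelˡ {c} {a} {b} {k} (mk≡mod k∣c+a-c+b) = mk≡mod (subst (+ k ∣_) ([c+a]-[c+b]≡a-b c a b) k∣c+a-c+b)

∣-<⇒≡0 : a < k → k ℕ∣ a → a ≡ 0
∣-<⇒≡0 {zero} _ _ = refl
∣-<⇒≡0 {suc a} a<k k∣a = ⊥-elim (>⇒∤ a<k k∣a)

mod-≤⇒≡ : b < k → a ≤ b → a ≡ b mod k → a ≡ b
mod-≤⇒≡ {b} {k} {a} b<k a≤b (mk≡mod k∣a-b) =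
  ≤-antisym a≤b (m∸n≡0⇒m≤n (∣-<⇒≡0 (≤-<-trans (m∸n≤m b a) b<k) k∣b∸a))
  where
  k∣b∸a : k ℕ∣ b ∸ a
  k∣b∸a = subst (k ℕ∣_) (trans (cong ℤ.∣_∣ ([+m]-[+n]≡m⊖n a b)) (∣⊖∣-≤ a≤b)) k∣a-b

mod-<⇒≡ : a < k → b < k → a ≡ b mod k → a ≡ b
mod-<⇒≡ {a} {b = b} a<k b<k a≡b with ≤-total a b
... | inj₁ a≤b = mod-≤⇒≡ b<k a≤b a≡b
... | inj₂ b≤a = sym (mod-≤⇒≡ a<k b≤a (mod-sym a≡b))

coordSum-[]≔ : (v : Vertex n k) (i : Fin n) (x : Fin k) →
               coordSum v + toℕ x ≡ coordSum (v [ i ]≔ x) + toℕ (lookup v i)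
coordSum-[]≔ (y ∷ v) fzero x =
  solve 3 (λ a b c → (a :+ b) :+ c := (c :+ b) :+ a) refl (toℕ y) (coordSum v) (toℕ x)
  where open ℕ-Solver
coordSum-[]≔ (y ∷ v) (fsuc i) x = begin
  toℕ y + coordSum v + toℕ x                          ≡⟨ +-assoc (toℕ y) _ _ ⟩
  toℕ y + (coordSum v + toℕ x)                        ≡⟨ cong (λ m → toℕ y + m) (coordSum-[]≔ v i x) ⟩
  toℕ y + (coordSum (v [ i ]≔ x) + toℕ (lookup v i))  ≡⟨ +-assoc (toℕ y) _ _ ⟨
  toℕ y + coordSum (v [ i ]≔ x) + toℕ (lookup v i)    ∎
  where open ≡-Reasoning

Adj⇒[]≔ : (v w : Vertex n k) → Adj v w → ∃₂ λ i x → lookup v i ≢ x × w ≡ v [ i ]≔ x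
Adj⇒[]≔ v w (i , v≢w , elsewhere) =
  i , lookup w i , v≢w , Pointwise-≡⇒≡ (ext agree)
  where
  agree : ∀ j → lookup w j ≡ lookup (v [ i ]≔ lookup w i) j
  agree j with j ≟ i
  ... | yes refl = sym (lookup∘update i v _)
  ... | no j≢i = trans (sym (elsewhere j j≢i)) (sym (lookup∘update′ j≢i v _))

leadStep : Fin k → Maybe (Fin k) → Maybe (Fin k)
leadStep _ (just t) = just t
leadStep fzero nothing = nothing
leadStep (fsuc t) nothing = just (fsuc t)

leadVal-∷ : (x : Fin k) (v : Vertex n k) → leadVal (x ∷ v) ≡ leadStep x (leadVal v)
leadVal-∷ x v with leadVal v
... | just _ = refl
... | nothing with x
...   | fzero = refl
...   | fsuc _ = refl

leadPosStep : Fin k → Maybe (Fin n) → Maybe (Fin (suc n))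
leadPosStep _ (just p) = just (fsuc p)
leadPosStep fzero nothing = nothing
leadPosStep (fsuc _) nothing = just fzero

-- ℓ(v), counted from 0.
leadPos : Vertex n k → Maybe (Fin n)
leadPos [] = nothing
leadPos (x ∷ v) = leadPosStep x (leadPos v)

leadVal≡nothing⇒leadPos≡nothing : (v : Vertex n k) → leadVal v ≡ nothing → leadPos v ≡ nothing
leadVal≡nothing⇒leadPos≡nothing [] _ = refl
leadVal≡nothing⇒leadPos≡nothing (x ∷ v) x∷v≡0
  with leadVal v in v≡0 | trans (sym (leadVal-∷ x v)) x∷v≡0
... | just _ | ()
... | nothing | x≡0 rewrite leadVal≡nothing⇒leadPos≡nothing v v≡0 = step x x≡0
  where
  step : (x : Fin k) → leadStep x nothing ≡ nothing → leadPosStep {n = n} x nothing ≡ nothing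
  step fzero _ = refl
  step (fsuc _) ()

leadVal-[]≔ : (v : Vertex n k) (i : Fin n) (x : Fin k) →
              leadPos v ≡ just i
              ⊎ leadVal (v [ i ]≔ x) ≡ leadVal v
              ⊎ (toℕ (lookup v i) ≡ 0 × leadVal (v [ i ]≔ x) ≡ just x)
leadVal-[]≔ (y ∷ v) fzero x rewrite leadVal-∷ x v | leadVal-∷ y v with leadVal v in v≡0
... | just _ = inj₂ (inj₁ refl)
... | nothing rewrite leadVal≡nothing⇒leadPos≡nothing v v≡0 = newHead y x
  where
  newHead : (y x : Fin k) →
            leadPosStep {n = n} y nothing ≡ just fzero
            ⊎ leadStep x nothing ≡ leadStep y nothing
            ⊎ (toℕ y ≡ 0 × leadStep x nothing ≡ just x)
  newHead (fsuc _) _ = inj₁ refl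
  newHead fzero fzero = inj₂ (inj₁ refl)
  newHead fzero (fsuc _) = inj₂ (inj₂ (refl , refl))
leadVal-[]≔ (y ∷ v) (fsuc i) x rewrite leadVal-∷ y (v [ i ]≔ x) | leadVal-∷ y v
  with leadVal-[]≔ v i x
... | inj₁ p = inj₁ (cong (leadPosStep y) p)
... | inj₂ (inj₁ same) = inj₂ (inj₁ (cong (leadStep y) same))
... | inj₂ (inj₂ (v[i]≡0 , new)) = inj₂ (inj₂ (v[i]≡0 , cong (leadStep y) new))

[]≔-sum-mod : (v : Vertex n k) (i : Fin n) (x : Fin k) →
              coordSum v ≡ s mod k → coordSum (v [ i ]≔ x) ≡ s′ mod k →
              s + toℕ x ≡ s′ + toℕ (lookup v i) mod k
[]≔-sum-mod v i x Sv Sw =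
  mod-trans (mod-+ʳ (mod-sym Sv)) (mod-trans (mod-reflexive (coordSum-[]≔ v i x)) (mod-+ʳ Sw))

[]≔-sum-changes : (v : Vertex n k) (i : Fin n) (x : Fin k) → lookup v i ≢ x →
                  coordSum v ≡ s mod k → coordSum (v [ i ]≔ x) ≡ s mod k → ⊥
[]≔-sum-changes v i x v[i]≢x Sv Sw = v[i]≢x (toℕ-injective (sym
  (mod-<⇒≡ (toℕ<n x) (toℕ<n (lookup v i)) (mod-cancelˡ ([]≔-sum-mod v i x Sv Sw)))))

[]≔-value-unique : (v : Vertex n k) (i : Fin n) (x x′ : Fin k) → coordSum v ≡ s mod k →
                   coordSum (v [ i ]≔ x) ≡ s′ mod k → coordSum (v [ i ]≔ x′) ≡ s′ mod k → x ≡ x′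
[]≔-value-unique v i x x′ Sv Sw Sw′ = toℕ-injective (mod-<⇒≡ (toℕ<n x) (toℕ<n x′)
  (mod-cancelˡ (mod-trans ([]≔-sum-mod v i x Sv Sw) (mod-sym ([]≔-sum-mod v i x′ Sv Sw′)))))

InW₁ InW₂ : Vertex n k → Set
InW₁ {k = k} v = Σ (Fin k) λ t → toℕ t ≡ 1 × InY 1 t v
InW₂ {k = k} v = Σ (Fin k) λ t → 2 ≤ toℕ t × InY 2 t v

W₁-neighbour : (v : Vertex n k) (i : Fin n) (x : Fin k) → lookup v i ≢ x →
               InW₁ v → InW (v [ i ]≔ x) → InW₂ (v [ i ]≔ x)
W₁-neighbour v i x v[i]≢x (_ , _ , Sv , _) (inj₁ (_ , _ , Sw , _)) =
  ⊥-elim ([]≔-sum-changes v i x v[i]≢x (mk≡mod {b = 1} Sv) (mk≡mod Sw))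
W₁-neighbour v i x v[i]≢x _ (inj₂ Y₂w) = Y₂w

W₂-neighbour : (v : Vertex n k) (i : Fin n) (x : Fin k) → lookup v i ≢ x →
               InW₂ v → InW (v [ i ]≔ x) → InW₁ (v [ i ]≔ x)
W₂-neighbour v i x v[i]≢x (_ , _ , Sv , _) (inj₂ (_ , _ , Sw , _)) =
  ⊥-elim ([]≔-sum-changes v i x v[i]≢x (mk≡mod {b = 2} Sv) (mk≡mod Sw))
W₂-neighbour v i x v[i]≢x _ (inj₁ Y₁w) = Y₁w

W-edge-at-lead : 3 ≤ k → (v : Vertex n k) (i : Fin n) (x : Fin k) → lookup v i ≢ x →
                 InW v → InW (v [ i ]≔ x) → leadPos v ≡ just i
W-edge-at-lead {k} k≥3 v i x v[i]≢x Wv Ww with leadVal-[]≔ v i x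
... | inj₁ at-lead = at-lead
... | inj₂ off-lead = ⊥-elim (contradiction Wv off-lead)
  where
  w = v [ i ]≔ x
  OffLead = leadVal w ≡ leadVal v ⊎ (toℕ (lookup v i) ≡ 0 × leadVal w ≡ just x)

  0<k : 0 < k
  0<k = ≤-trans (s≤s z≤n) k≥3
  1<k : 1 < k
  1<k = ≤-trans (s≤s (s≤s z≤n)) k≥3
  2<k : 2 < k
  2<k = k≥3

  one≢big : ∀ {t t′ : Fin k} → toℕ t ≡ 1 → 2 ≤ toℕ t′ → t′ ≢ t
  one≢big t≡1 2≤t′ refl = <⇒≢ 2≤t′ (sym t≡1)

  up : InW₁ v → InW₂ w → OffLead → ⊥
  up (t , t≡1 , _ , lv) (t′ , 2≤t′ , _ , lw) (inj₁ same) =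
    one≢big t≡1 2≤t′ (just-injective (trans (sym lw) (trans same lv)))
  up (_ , _ , Sv , _) (t′ , 2≤t′ , Sw , lw) (inj₂ (v[i]≡0 , lw′)) =
    one≢big x≡1 2≤t′ (just-injective (trans (sym lw) lw′))
    where
    x≡1 : toℕ x ≡ 1
    x≡1 = mod-<⇒≡ (toℕ<n x) 1<k (mod-cancelˡ {c = 1}
      (subst (λ a → 1 + toℕ x ≡ 2 + a mod k) v[i]≡0
        ([]≔-sum-mod v i x (mk≡mod {b = 1} Sv) (mk≡mod {b = 2} Sw))))

  down : InW₂ v → InW₁ w → OffLead → ⊥
  down (t , 2≤t , _ , lv) (t′ , t′≡1 , _ , lw) (inj₁ same) =
    one≢big t′≡1 2≤t (just-injective (trans (sym lv) (trans (sym same) lw)))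
  down (_ , _ , Sv , _) (t′ , t′≡1 , Sw , lw) (inj₂ (v[i]≡0 , lw′)) =
    2≢0 (mod-<⇒≡ 2<k 0<k (mod-cancelˡ {c = 1}
      (subst₂ (λ a b → 2 + a ≡ 1 + b mod k) x≡1 v[i]≡0
        ([]≔-sum-mod v i x (mk≡mod {b = 2} Sv) (mk≡mod {b = 1} Sw)))))
    where
    x≡1 : toℕ x ≡ 1
    x≡1 = trans (cong toℕ (just-injective (trans (sym lw′) lw))) t′≡1
    2≢0 : 2 ≢ 0
    2≢0 ()

  contradiction : InW v → OffLead → ⊥
  contradiction (inj₁ Y₁v) = up Y₁v (W₁-neighbour v i x v[i]≢x Y₁v Ww)
  contradiction (inj₂ Y₂v) = down Y₂v (W₂-neighbour v i x v[i]≢x Y₂v Ww)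

W-edge-value : (v : Vertex n k) (i : Fin n) (x x′ : Fin k) → lookup v i ≢ x → lookup v i ≢ x′ →
               InW v → InW (v [ i ]≔ x) → InW (v [ i ]≔ x′) → x ≡ x′
W-edge-value v i x x′ v[i]≢x v[i]≢x′ (inj₁ Y₁v@(_ , _ , Sv , _)) Ww Ww′
  with W₁-neighbour v i x v[i]≢x Y₁v Ww | W₁-neighbour v i x′ v[i]≢x′ Y₁v Ww′
... | _ , _ , Sw , _ | _ , _ , Sw′ , _ =
  []≔-value-unique v i x x′ (mk≡mod {b = 1} Sv) (mk≡mod {b = 2} Sw) (mk≡mod Sw′)
W-edge-value v i x x′ v[i]≢x v[i]≢x′ (inj₂ Y₂v@(_ , _ , Sv , _)) Ww Ww′
  with W₂-neighbour v i x v[i]≢x Y₂v Ww | W₂-neighbour v i x′ v[i]≢x′ Y₂v Ww′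
... | _ , _ , Sw , _ | _ , _ , Sw′ , _ =
  []≔-value-unique v i x x′ (mk≡mod {b = 2} Sv) (mk≡mod {b = 1} Sw) (mk≡mod Sw′)

W-neighbour-unique : 3 ≤ k → (v w w′ : Vertex n k) → InW v → InW w → InW w′ →
                     Adj v w → Adj v w′ → w ≡ w′
W-neighbour-unique k≥3 v w w′ Wv Ww Ww′ v~w v~w′
  with i , x , v[i]≢x , refl ← Adj⇒[]≔ v w v~w
  with i′ , x′ , v[i′]≢x′ , refl ← Adj⇒[]≔ v w′ v~w′
  with refl ← just-injective (trans (sym (W-edge-at-lead k≥3 v i x v[i]≢x Wv Ww))
                                    (W-edge-at-lead k≥3 v i′ x′ v[i′]≢x′ Wv Ww′))
  = cong (v [ i ]≔_) (W-edge-value v i x x′ v[i]≢x v[i′]≢x′ Wv Ww Ww′)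

coordSum-zeros : ∀ m → coordSum (replicate m (fzero {k})) ≡ 0
coordSum-zeros zero = refl
coordSum-zeros (suc m) = coordSum-zeros m

leadVal-zeros : ∀ m → leadVal (replicate m (fzero {k})) ≡ nothing
leadVal-zeros zero = refl
leadVal-zeros (suc m) = trans (leadVal-∷ fzero (replicate m fzero)) (cong (leadStep fzero) (leadVal-zeros m))

W-edge-exists : ∀ m → 3 ≤ k → Σ (Vertex (suc m) k) λ v → Σ (Vertex (suc m) k) λ w → InW v × InW w × Adj v w
W-edge-exists {k = suc (suc (suc k′))} m (s≤s (s≤s (s≤s _))) =
  one ∷ zeros , two ∷ zeros ,
  inj₁ (one , refl , _≡_mod_.divides (sum≡head one) , lead≡head fzero) ,
  inj₂ (two , s≤s (s≤s z≤n) , _≡_mod_.divides (sum≡head two) , lead≡head (fsuc fzero)) ,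
  fzero , (λ ()) , λ { fzero j≢0 → ⊥-elim (j≢0 refl) ; (fsuc _) _ → refl }
  where
  zeros = replicate m fzero
  one two : Fin (3 + k′)
  one = fsuc fzero
  two = fsuc (fsuc fzero)

  sum≡head : (x : Fin (3 + k′)) → coordSum (x ∷ zeros) ≡ toℕ x mod (3 + k′)
  sum≡head x = mod-reflexive (trans (cong (λ s → toℕ x + s) (coordSum-zeros m)) (+-identityʳ (toℕ x)))

  lead≡head : (x : Fin (2 + k′)) → leadVal (fsuc x ∷ zeros) ≡ just (fsuc x)
  lead≡head x = trans (leadVal-∷ (fsuc x) zeros) (cong (leadStep (fsuc x)) (leadVal-zeros m))

lemma16 : (n k : ℕ) → n ≥ 1 → k ≥ 3 →
    ((v w w′ : Vertex n k) → InW v → InW w → InW w′ →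
       Adj v w → Adj v w′ → w ≡ w′)
    × (Σ (Vertex n k) λ v → Σ (Vertex n k) λ w → InW v × InW w × Adj v w)
lemma16 (suc m) k (s≤s z≤n) k≥3 = W-neighbour-unique k≥3 , W-edge-exists m k≥3
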